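{- Let $x$ be a sequence of pairwise distinct integers of length $m$, $i\in\{1,\ldots,m-1\}$ and $y=\tau(x,i)$. If $\mathrm{ref}_y(i)\neq -1$ and $\mathrm{ref}_x(i+1)\neq -1$, then $SN_x[\mathrm{ref}_y(i)]\neq SN_y[\mathrm{ref}_y(i)]$ if and only if $SN_x[\mathrm{ref}_x(i+1)]\neq SN_y[\mathrm{ref}_x(i+1)]$.
   Context: $\tau(x,i)$ exchanges $x[i]$ and $x[i+1]$. The Cartesian tree $C(x)$ of $x[1\ldots m]$ has as root the node labeled by the position $g$ of the minimum of $x$, left subtree $C(x[1\ldots g-1])$ and right subtree the Cartesian tree of $x[g+1\ldots m]$ (nodes labeled by positions). $C_h(x)$ is the subtree rooted at node $h$. $SN_x[h]$ is the number of nodes on the right branch (root and successive right children) of the left subtree of $C_h(x)$ ($0$ if that subtree is empty). $\mathrm{ref}_x(h)$ is the smallest position $j>h$ with $x[j]<x[h]$, and $-1$ if none exists. -}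

module Defs where

open import Data.Nat using (ℕ; zero; suc; _≡ᵇ_)
open import Data.Integer using (ℤ; _<?_)
open import Data.List using (List; []; _∷_; length)
open import Data.Maybe using (Maybe; just; nothing)
open import Data.Product using (_×_; _,_; proj₁; proj₂)
open import Data.Bool using (Bool; true; false; if_then_else_)
open import Relation.Nullary.Decidable using (⌊_⌋)

-- Sequences are lists of integers; positions are 1-indexed natural numbers.

_!_ : List ℤ → ℕ → Maybe ℤ
[] ! _ = nothing
(a ∷ xs) ! zero = nothing
(a ∷ xs) ! suc zero = just a
(a ∷ xs) ! suc (suc k) = xs ! suc k

τ : List ℤ → ℕ → List ℤ
τ (a ∷ b ∷ xs) (suc zero) = b ∷ a ∷ xs
τ (a ∷ xs) (suc (suc k)) = a ∷ τ xs (suc k)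
τ xs _ = xs

indexedFrom : ℕ → List ℤ → List (ℕ × ℤ)
indexedFrom n [] = []
indexedFrom n (a ∷ xs) = (n , a) ∷ indexedFrom (suc n) xs

indexed : List ℤ → List (ℕ × ℤ)
indexed = indexedFrom 1

-- ref_x(h): smallest position j > h with x[j] < x[h]; nothing encodes -1
firstBelow : ℤ → List (ℕ × ℤ) → Maybe ℕ
firstBelow v [] = nothing
firstBelow v ((j , w) ∷ ps) = if ⌊ w <? v ⌋ then just j else firstBelow v ps

dropN : ℕ → List (ℕ × ℤ) → List (ℕ × ℤ)
dropN zero ps = ps
dropN (suc n) [] = []
dropN (suc n) (p ∷ ps) = dropN n ps

ref : List ℤ → ℕ → Maybe ℕ
ref x h with x ! h
... | nothing = nothing
... | just v = firstBelow v (dropN h (indexed x))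

data Tree : Set where
  leaf : Tree
  node : Tree → ℕ → Tree → Tree

splitMin : ℕ × ℤ → List (ℕ × ℤ) → List (ℕ × ℤ) × (ℕ × ℤ) × List (ℕ × ℤ)
splitMin p [] = [] , p , []
splitMin p (q ∷ qs) with splitMin q qs
... | (L , g , R) =
  if ⌊ proj₂ g <? proj₂ p ⌋ then (p ∷ L , g , R) else ([] , p , q ∷ qs)

-- Cartesian tree construction; the fuel argument is ≥ the list length
build : ℕ → List (ℕ × ℤ) → Tree
build zero _ = leaf
build (suc n) [] = leaf
build (suc n) (p ∷ ps) with splitMin p ps
... | (L , g , R) = node (build n L) (proj₁ g) (build n R)

C : List ℤ → Tree
C x = build (length x) (indexed x)

firstJust : Maybe Tree → Maybe Tree → Maybe Tree
firstJust (just t) _ = just t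
firstJust nothing m = m

subtree : ℕ → Tree → Maybe Tree
subtree h leaf = nothing
subtree h (node l g r) =
  if h ≡ᵇ g then just (node l g r) else firstJust (subtree h l) (subtree h r)

rightBranch : Tree → ℕ
rightBranch leaf = 0
rightBranch (node l g r) = suc (rightBranch r)

SN : List ℤ → ℕ → ℕ
SN x h with subtree h (C x)
... | just (node l g r) = rightBranch l
... | _ = 0

{-# OPTIONS --safe #-}
-- In a Cartesian tree the left subtree of node h is the Cartesian tree of the maximal run of
-- entries immediately left of h whose values exceed x[h], and the right branch of the Cartesian
-- tree of a list consists of its suffix minima; hence SN_x[h] counts the suffix minima of that
-- run. Write a = x[i] and b = x[i+1]. If a ≥ b then ref_y(i) = ref_x(i+1) and there is nothing
-- to prove. If a < b then ref_y(i) = i+1, whose run is empty in x but ends with b in y. At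
-- s = ref_x(i+1), with c = x[s] < b and all entries M strictly between i+1 and s at least b,
-- the runs in x and y end in a b M and b a M when c < a (2 versus 1 suffix minima in front of
-- those of M), and are b M and M when a ≤ c. So both sides of the equivalence hold.
module Submission where

open import Defs
open import Data.Bool using (Bool; true; false; if_then_else_; _∧_)
open import Data.Bool.Properties using (T-≡; ¬-not; ∧-zeroʳ)
open import Data.Empty using (⊥-elim)
open import Data.Integer using (ℤ; _<?_; _≤?_) renaming (_<_ to _<ℤ_; _≤_ to _≤ℤ_)
import Data.Integer.Properties as ℤ
open import Data.List using (List; []; _∷_; _++_; [_]; length; foldl)
open import Data.List.Properties
  using (++-assoc; ++-identityʳ; ∷-injective; foldl-++; length-++; length-++-≤ˡ; length-++-≤ʳ; length-++-sucʳ)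
open import Data.List.Relation.Unary.All as All using (All; []; _∷_)
open import Data.List.Relation.Unary.All.Properties using (++⁺; ++⁻; ++⁻ˡ; ++⁻ʳ)
open import Data.List.Relation.Unary.Unique.Propositional using (Unique)
open import Data.Maybe using (just; nothing)
open import Data.Maybe.Properties using (just-injective)
open import Data.Nat using (ℕ; zero; suc; _+_; _≤_; _<_; _≡ᵇ_; s≤s; s≤s⁻¹)
import Data.Nat.Properties as ℕ
open import Data.Product using (_×_; _,_; proj₁; proj₂; ∃; ∃₂)
open import Data.Sum using (_⊎_; inj₁; inj₂)
open import Function using (_∘_)
open import Function.Bundles using (_⇔_; mk⇔; Equivalence)
open import Function.Properties.Equivalence using () renaming (refl to ⇔-refl)
open import Relation.Nullary using (yes; no)
open import Relation.Nullary.Decidable using (⌊_⌋)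
open import Relation.Binary.PropositionalEquality
  using (_≡_; _≢_; refl; sym; trans; cong; cong₂; subst; module ≡-Reasoning)
open ≡-Reasoning

Entry : Set
Entry = ℕ × ℤ

pos : Entry → ℕ
pos = proj₁

val : Entry → ℤ
val = proj₂

isLowerBound : ℤ → List Entry → Bool
isLowerBound v []       = true
isLowerBound v (q ∷ qs) = ⌊ v ≤? val q ⌋ ∧ isLowerBound v qs

#suffixMinima : List Entry → ℕ
#suffixMinima []       = 0
#suffixMinima (q ∷ qs) = (if isLowerBound (val q) qs then 1 else 0) + #suffixMinima qs

extendRun : ℤ → List Entry → Entry → List Entry
extendRun v run q = if ⌊ v <? val q ⌋ then run ++ [ q ] else []

-- The maximal suffix of a list all of whose values exceed v.
leftRun : ℤ → List Entry → List Entry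
leftRun v = foldl (extendRun v) []

isLowerBound-++ : ∀ v qs rs → isLowerBound v (qs ++ rs) ≡ isLowerBound v qs ∧ isLowerBound v rs
isLowerBound-++ v []       rs = refl
isLowerBound-++ v (q ∷ qs) rs rewrite isLowerBound-++ v qs rs with ⌊ v ≤? val q ⌋
... | true  = refl
... | false = refl

isLowerBound-true : ∀ {v} qs → All (λ q → v ≤ℤ val q) qs → isLowerBound v qs ≡ true
isLowerBound-true []       []           = refl
isLowerBound-true {v} (q ∷ qs) (v≤q ∷ v≤qs) with v ≤? val q
... | yes _   = isLowerBound-true qs v≤qs
... | no  v≰q = ⊥-elim (v≰q v≤q)

isLowerBound-swap : ∀ v i j a b qs →
  isLowerBound v ((i , a) ∷ (j , b) ∷ qs) ≡ isLowerBound v ((i , b) ∷ (j , a) ∷ qs)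
isLowerBound-swap v i j a b qs with ⌊ v ≤? a ⌋ | ⌊ v ≤? b ⌋
... | true  | true  = refl
... | true  | false = refl
... | false | true  = refl
... | false | false = refl

#suffixMinima-∷-lowerBound : ∀ q qs → All (λ r → val q ≤ℤ val r) qs →
  #suffixMinima (q ∷ qs) ≡ suc (#suffixMinima qs)
#suffixMinima-∷-lowerBound q qs q≤qs rewrite isLowerBound-true qs q≤qs = refl

#suffixMinima-∷-descent : ∀ p q qs → val q <ℤ val p →
  #suffixMinima (p ∷ q ∷ qs) ≡ #suffixMinima (q ∷ qs)
#suffixMinima-∷-descent p q qs q<p with val p ≤? val q
... | yes p≤q = ⊥-elim (ℤ.<⇒≱ q<p p≤q)
... | no  _   = refl

#suffixMinima-above-++ : ∀ L g R → All (λ q → val g <ℤ val q) L →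
  #suffixMinima (L ++ g ∷ R) ≡ #suffixMinima (g ∷ R)
#suffixMinima-above-++ []      g R []          = refl
#suffixMinima-above-++ (q ∷ L) g R (g<q ∷ g<L)
  rewrite isLowerBound-++ (val q) L (g ∷ R) with val q ≤? val g
... | yes q≤g = ⊥-elim (ℤ.<⇒≱ g<q q≤g)
... | no  _   rewrite ∧-zeroʳ (isLowerBound (val q) L) = #suffixMinima-above-++ L g R g<L

#suffixMinima-∷ʳ-nonzero : ∀ qs q → #suffixMinima (qs ++ [ q ]) ≢ 0
#suffixMinima-∷ʳ-nonzero []       q ()
#suffixMinima-∷ʳ-nonzero (p ∷ qs) q e = #suffixMinima-∷ʳ-nonzero qs q (ℕ.m+n≡0⇒n≡0 _ e)

-- Entries of S see T and T' alike, so they contribute equally on both sides.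
#suffixMinima-++-cancelˡ : ∀ S T T' → (∀ v → isLowerBound v T ≡ isLowerBound v T') →
  #suffixMinima (S ++ T) ≡ #suffixMinima (S ++ T') → #suffixMinima T ≡ #suffixMinima T'
#suffixMinima-++-cancelˡ []      T T' same e = e
#suffixMinima-++-cancelˡ (q ∷ S) T T' same e
  rewrite isLowerBound-++ (val q) S T | isLowerBound-++ (val q) S T' | same (val q) =
  #suffixMinima-++-cancelˡ S T T' same (ℕ.+-cancelˡ-≡ _ _ _ e)

foldl-extendRun-above : ∀ v run M → All (λ q → v <ℤ val q) M → foldl (extendRun v) run M ≡ run ++ M
foldl-extendRun-above v run []      []          = sym (++-identityʳ run)
foldl-extendRun-above v run (q ∷ M) (v<q ∷ v<M) with v <? val q
... | yes _   = trans (foldl-extendRun-above v (run ++ [ q ]) M v<M) (++-assoc run [ q ] M)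
... | no  v≮q = ⊥-elim (v≮q v<q)

leftRun-++-above : ∀ v S M → All (λ q → v <ℤ val q) M → leftRun v (S ++ M) ≡ leftRun v S ++ M
leftRun-++-above v S M v<M =
  trans (foldl-++ (extendRun v) [] S M) (foldl-extendRun-above v (leftRun v S) M v<M)

leftRun-above : ∀ v M → All (λ q → v <ℤ val q) M → leftRun v M ≡ M
leftRun-above v = leftRun-++-above v []

leftRun-++-atMost : ∀ v L g R → val g ≤ℤ v → leftRun v (L ++ g ∷ R) ≡ leftRun v R
leftRun-++-atMost v L g R g≤v rewrite foldl-++ (extendRun v) [] L (g ∷ R) with v <? val g
... | yes v<g = ⊥-elim (ℤ.<⇒≱ v<g g≤v)
... | no  _   = refl

#suffixMinima-leftRun-ascent : ∀ S i {a b} → a <ℤ b →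
  #suffixMinima (leftRun b (S ++ [ (i , a) ])) ≢ #suffixMinima (leftRun a (S ++ [ (i , b) ]))
#suffixMinima-leftRun-ascent S i {a} {b} a<b e = #suffixMinima-∷ʳ-nonzero (leftRun a S) (i , b) (begin
  #suffixMinima (leftRun a S ++ [ (i , b) ])
    ≡⟨ cong #suffixMinima (leftRun-++-above a S _ (a<b ∷ [])) ⟨
  #suffixMinima (leftRun a (S ++ [ (i , b) ]))
    ≡⟨ e ⟨
  #suffixMinima (leftRun b (S ++ [ (i , a) ]))
    ≡⟨ cong #suffixMinima (leftRun-++-atMost b S _ [] (ℤ.<⇒≤ a<b)) ⟩
  0 ∎)

#suffixMinima-leftRun-swap-below : ∀ S i j {a b c} M → c <ℤ a → a <ℤ b → All (λ q → b ≤ℤ val q) M →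
  #suffixMinima (leftRun c (S ++ (i , a) ∷ (j , b) ∷ M)) ≢
  #suffixMinima (leftRun c (S ++ (i , b) ∷ (j , a) ∷ M))
#suffixMinima-leftRun-swap-below S i j {a} {b} {c} M c<a a<b b≤M e = ℕ.1+n≢n (begin
  suc (suc (#suffixMinima M))
    ≡⟨ cong suc (#suffixMinima-∷-lowerBound (j , b) M b≤M) ⟨
  suc (#suffixMinima ((j , b) ∷ M))
    ≡⟨ #suffixMinima-∷-lowerBound (i , a) ((j , b) ∷ M) (ℤ.<⇒≤ a<b ∷ a≤M) ⟨
  #suffixMinima ((i , a) ∷ (j , b) ∷ M)
    ≡⟨ #suffixMinima-++-cancelˡ (leftRun c S) _ _ (λ v → isLowerBound-swap v i j a b M) runs-equal ⟩
  #suffixMinima ((i , b) ∷ (j , a) ∷ M)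
    ≡⟨ #suffixMinima-∷-descent (i , b) (j , a) M a<b ⟩
  #suffixMinima ((j , a) ∷ M)
    ≡⟨ #suffixMinima-∷-lowerBound (j , a) M a≤M ⟩
  suc (#suffixMinima M) ∎)
  where
  a≤M : All (λ q → a ≤ℤ val q) M
  a≤M = All.map (ℤ.≤-trans (ℤ.<⇒≤ a<b)) b≤M
  c<b : c <ℤ b
  c<b = ℤ.<-trans c<a a<b
  c<M : All (λ q → c <ℤ val q) M
  c<M = All.map (ℤ.<-≤-trans c<b) b≤M
  runs-equal : #suffixMinima (leftRun c S ++ (i , a) ∷ (j , b) ∷ M) ≡
               #suffixMinima (leftRun c S ++ (i , b) ∷ (j , a) ∷ M)
  runs-equal = begin
    #suffixMinima (leftRun c S ++ (i , a) ∷ (j , b) ∷ M)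
      ≡⟨ cong #suffixMinima (leftRun-++-above c S _ (c<a ∷ c<b ∷ c<M)) ⟨
    #suffixMinima (leftRun c (S ++ (i , a) ∷ (j , b) ∷ M))
      ≡⟨ e ⟩
    #suffixMinima (leftRun c (S ++ (i , b) ∷ (j , a) ∷ M))
      ≡⟨ cong #suffixMinima (leftRun-++-above c S _ (c<b ∷ c<a ∷ c<M)) ⟩
    #suffixMinima (leftRun c S ++ (i , b) ∷ (j , a) ∷ M) ∎

#suffixMinima-leftRun-swap-between : ∀ S i j {a b c} M → a ≤ℤ c → c <ℤ b → All (λ q → b ≤ℤ val q) M →
  #suffixMinima (leftRun c (S ++ (i , a) ∷ (j , b) ∷ M)) ≢
  #suffixMinima (leftRun c (S ++ (i , b) ∷ (j , a) ∷ M))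
#suffixMinima-leftRun-swap-between S i j {a} {b} {c} M a≤c c<b b≤M e = ℕ.1+n≢n (begin
  suc (#suffixMinima M)
    ≡⟨ #suffixMinima-∷-lowerBound (j , b) M b≤M ⟨
  #suffixMinima ((j , b) ∷ M)
    ≡⟨ cong #suffixMinima (leftRun-above c _ (c<b ∷ c<M)) ⟨
  #suffixMinima (leftRun c ((j , b) ∷ M))
    ≡⟨ cong #suffixMinima (leftRun-++-atMost c S (i , a) _ a≤c) ⟨
  #suffixMinima (leftRun c (S ++ (i , a) ∷ (j , b) ∷ M))
    ≡⟨ e ⟩
  #suffixMinima (leftRun c (S ++ (i , b) ∷ (j , a) ∷ M))
    ≡⟨ cong (#suffixMinima ∘ leftRun c) (++-assoc S [ (i , b) ] _) ⟨
  #suffixMinima (leftRun c ((S ++ [ (i , b) ]) ++ (j , a) ∷ M))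
    ≡⟨ cong #suffixMinima (leftRun-++-atMost c (S ++ [ (i , b) ]) (j , a) M a≤c) ⟩
  #suffixMinima (leftRun c M)
    ≡⟨ cong #suffixMinima (leftRun-above c M c<M) ⟩
  #suffixMinima M ∎)
  where
  c<M : All (λ q → c <ℤ val q) M
  c<M = All.map (ℤ.<-≤-trans c<b) b≤M

#suffixMinima-leftRun-swap : ∀ S i j {a b c} M → a <ℤ b → c <ℤ b → All (λ q → b ≤ℤ val q) M →
  #suffixMinima (leftRun c (S ++ (i , a) ∷ (j , b) ∷ M)) ≢
  #suffixMinima (leftRun c (S ++ (i , b) ∷ (j , a) ∷ M))
#suffixMinima-leftRun-swap S i j {a} {c = c} M a<b c<b b≤M with c <? a
... | yes c<a = #suffixMinima-leftRun-swap-below S i j M c<a a<b b≤M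
... | no  c≮a = #suffixMinima-leftRun-swap-between S i j M (ℤ.≮⇒≥ c≮a) c<b b≤M

data MinSplit (ps : List Entry) : List Entry × Entry × List Entry → Set where
  minSplit : ∀ {L g R} → L ++ g ∷ R ≡ ps → All (λ q → val g <ℤ val q) L → All (λ q → val g ≤ℤ val q) R →
             MinSplit ps (L , g , R)

splitMin-minSplit : ∀ p ps → MinSplit (p ∷ ps) (splitMin p ps)
splitMin-minSplit p []       = minSplit refl [] []
splitMin-minSplit p (q ∷ qs) with splitMin q qs | splitMin-minSplit q qs
... | L , g , R | minSplit e g<L g≤R with proj₂ g <? proj₂ p
...   | yes g<p = minSplit (cong (p ∷_) e) (g<p ∷ g<L) g≤R
...   | no  g≮p = minSplit refl [] (subst (All _) e
          (++⁺ (All.map (λ g<r → ℤ.≤-trans p≤g (ℤ.<⇒≤ g<r)) g<L) (p≤g ∷ All.map (ℤ.≤-trans p≤g) g≤R)))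
  where
  p≤g : val p ≤ℤ val g
  p≤g = ℤ.≮⇒≥ g≮p

fuel-split : ∀ {n} L (g : Entry) R → length (L ++ g ∷ R) ≤ suc n → length L ≤ n × length R ≤ n
fuel-split {n} L g R le = ℕ.≤-trans (length-++-≤ˡ L) le′ , ℕ.≤-trans (length-++-≤ʳ R {L}) le′
  where
  le′ : length (L ++ R) ≤ n
  le′ = s≤s⁻¹ (subst (_≤ suc n) (length-++-sucʳ L g R) le)

data CutComparison {A : Set} : List A → A → List A → List A → A → List A → Set where
  cut-before : ∀ {Pre x M g R} → CutComparison Pre x (M ++ g ∷ R) (Pre ++ x ∷ M) g R
  cut-same   : ∀ {Pre x Q} → CutComparison Pre x Q Pre x Q
  cut-after  : ∀ {L g M x Q} → CutComparison (L ++ g ∷ M) x Q L g (M ++ x ∷ Q)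

compareCuts : ∀ {A : Set} Pre (x : A) Q L g R → Pre ++ x ∷ Q ≡ L ++ g ∷ R → CutComparison Pre x Q L g R
compareCuts []        x Q []      g R refl = cut-same
compareCuts []        x Q (l ∷ L) g R refl = cut-before
compareCuts (p ∷ Pre) x Q []      g R refl = cut-after
compareCuts (p ∷ Pre) x Q (l ∷ L) g R e with ∷-injective e
... | refl , e′ with compareCuts Pre x Q L g R e′
...   | cut-before = cut-before
...   | cut-same   = cut-same
...   | cut-after  = cut-after

≡ᵇ-refl : ∀ n → (n ≡ᵇ n) ≡ true
≡ᵇ-refl n = Equivalence.to T-≡ (ℕ.≡⇒≡ᵇ n n refl)

≢⇒≡ᵇ-false : ∀ {m n} → m ≢ n → (m ≡ᵇ n) ≡ false
≢⇒≡ᵇ-false {m} {n} m≢n = ¬-not (λ e → m≢n (ℕ.≡ᵇ⇒≡ m n (Equivalence.from T-≡ e)))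

subtree-absent : ∀ n ps h → All (λ q → pos q ≢ h) ps → subtree h (build n ps) ≡ nothing
subtree-absent zero    ps       h _  = refl
subtree-absent (suc n) []       h _  = refl
subtree-absent (suc n) (p ∷ ps) h ≢h with splitMin p ps | splitMin-minSplit p ps
... | L , g , R | minSplit e _ _ with ++⁻ L (subst (All _) (sym e) ≢h)
...   | L≢h , g≢h ∷ R≢h
  rewrite ≢⇒≡ᵇ-false (g≢h ∘ sym) | subtree-absent n L h L≢h | subtree-absent n R h R≢h = refl

rightBranch-build : ∀ n ps → length ps ≤ n → rightBranch (build n ps) ≡ #suffixMinima ps
rightBranch-build zero    []       _  = refl
rightBranch-build (suc n) []       _  = refl
rightBranch-build (suc n) (p ∷ ps) le with splitMin p ps | splitMin-minSplit p ps
... | L , g , R | minSplit e g<L g≤R = begin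
  suc (rightBranch (build n R)) ≡⟨ cong suc (rightBranch-build n R (proj₂ (fuel-split L g R le′))) ⟩
  suc (#suffixMinima R)         ≡⟨ #suffixMinima-∷-lowerBound g R g≤R ⟨
  #suffixMinima (g ∷ R)         ≡⟨ #suffixMinima-above-++ L g R g<L ⟨
  #suffixMinima (L ++ g ∷ R)    ≡⟨ cong #suffixMinima e ⟩
  #suffixMinima (p ∷ ps)        ∎
  where
  le′ : length (L ++ g ∷ R) ≤ suc n
  le′ = subst (λ qs → length qs ≤ suc n) (sym e) le

subtree-node-left : ∀ {h l g r t} → h ≢ g → subtree h l ≡ just t → subtree h (node l g r) ≡ just t
subtree-node-left h≢g found rewrite ≢⇒≡ᵇ-false h≢g | found = refl

subtree-node-right : ∀ {h l g r t} → h ≢ g → subtree h l ≡ nothing → subtree h r ≡ just t →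
  subtree h (node l g r) ≡ just t
subtree-node-right h≢g absent found rewrite ≢⇒≡ᵇ-false h≢g | absent | found = refl

subtree-build : ∀ n ps Pre h v Q → ps ≡ Pre ++ (h , v) ∷ Q → length ps ≤ n →
  All (λ q → pos q < h) Pre → All (λ q → h < pos q) Q →
  ∃₂ λ m r → subtree h (build n ps) ≡ just (node (build m (leftRun v Pre)) h r)
            × length (leftRun v Pre) ≤ m
subtree-build n       []       []      h v Q () _  _  _
subtree-build n       []       (_ ∷ _) h v Q () _  _  _
subtree-build zero    (_ ∷ _)  Pre     h v Q _  () _  _
subtree-build (suc n) (p ∷ ps) Pre     h v Q eq le <h h< with splitMin p ps | splitMin-minSplit p ps
... | L , g , R | minSplit e g<L g≤R
  with fuel-split L g R (subst (λ qs → length qs ≤ suc n) (sym e) le)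
     | compareCuts Pre (h , v) Q L g R (trans (sym eq) (sym e))
...   | fuelL , _ | cut-same rewrite ≡ᵇ-refl h | leftRun-above v Pre g<L = n , build n R , refl , fuelL
...   | fuelL , _ | cut-before {M = M} =
  let m , r , found , fuel = subtree-build n L Pre h v M refl fuelL <h (++⁻ˡ M h<)
  in  m , r , subtree-node-left (ℕ.<⇒≢ (All.head (++⁻ʳ M h<))) found , fuel
...   | _ , fuelR | cut-after {M = M} rewrite leftRun-++-atMost v L g M (All.head (++⁻ʳ M g≤R)) =
  let m , r , found , fuel = subtree-build n R M h v Q refl fuelR (All.tail (++⁻ʳ L <h)) h<
  in  m , r , subtree-node-right (ℕ.>⇒≢ (All.head (++⁻ʳ L <h)))
                (subtree-absent n L h (All.map ℕ.<⇒≢ (++⁻ˡ L <h))) found , fuel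

length-indexedFrom : ∀ k z → length (indexedFrom k z) ≡ length z
length-indexedFrom k []      = refl
length-indexedFrom k (a ∷ z) = cong suc (length-indexedFrom (suc k) z)

indexedFrom-pos-≥ : ∀ k z → All (λ q → k ≤ pos q) (indexedFrom k z)
indexedFrom-pos-≥ k []      = []
indexedFrom-pos-≥ k (a ∷ z) = ℕ.≤-refl ∷ All.map ℕ.<⇒≤ (indexedFrom-pos-≥ (suc k) z)

indexedFrom-++ : ∀ k A C → indexedFrom k (A ++ C) ≡ indexedFrom k A ++ indexedFrom (k + length A) C
indexedFrom-++ k []      C = cong (λ n → indexedFrom n C) (sym (ℕ.+-identityʳ k))
indexedFrom-++ k (a ∷ A) C = cong ((k , a) ∷_) (begin
  indexedFrom (suc k) (A ++ C)
    ≡⟨ indexedFrom-++ (suc k) A C ⟩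
  indexedFrom (suc k) A ++ indexedFrom (suc k + length A) C
    ≡⟨ cong (λ n → indexedFrom (suc k) A ++ indexedFrom n C) (ℕ.+-suc k (length A)) ⟨
  indexedFrom (suc k) A ++ indexedFrom (k + suc (length A)) C ∎)

indexedFrom-split : ∀ k z Pre h v Q → indexedFrom k z ≡ Pre ++ (h , v) ∷ Q →
  All (λ q → pos q < h) Pre × All (λ q → h < pos q) Q
indexedFrom-split k []      []        h v Q ()
indexedFrom-split k []      (_ ∷ _)   h v Q ()
indexedFrom-split k (a ∷ z) []        h v Q refl = [] , indexedFrom-pos-≥ (suc k) z
indexedFrom-split k (a ∷ z) (p ∷ Pre) h v Q eq with ∷-injective eq
... | refl , eq′ =
  let Pre<h , h<Q = indexedFrom-split (suc k) z Pre h v Q eq′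
      k<h = All.head (++⁻ʳ Pre (subst (All _) eq′ (indexedFrom-pos-≥ (suc k) z)))
  in  k<h ∷ Pre<h , h<Q

SN-found : ∀ z h {l g r} → subtree h (C z) ≡ just (node l g r) → SN z h ≡ rightBranch l
SN-found z h found rewrite found = refl

SN-leftRun : ∀ z Pre h v Q → indexed z ≡ Pre ++ (h , v) ∷ Q → SN z h ≡ #suffixMinima (leftRun v Pre)
SN-leftRun z Pre h v Q eq =
  let Pre<h , h<Q = indexedFrom-split 1 z Pre h v Q eq
      m , _ , found , fuel = subtree-build (length z) (indexed z) Pre h v Q eq
                               (ℕ.≤-reflexive (length-indexedFrom 1 z)) Pre<h h<Q
  in  trans (SN-found z h found) (rightBranch-build m _ fuel)

!-++ : ∀ A (v : ℤ) B → (A ++ v ∷ B) ! suc (length A) ≡ just v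
!-++ []      v B = refl
!-++ (a ∷ A) v B = !-++ A v B

dropN-++ : ∀ ps q qs {n} → length ps ≡ n → dropN (suc n) (ps ++ q ∷ qs) ≡ qs
dropN-++ []       q qs refl = refl
dropN-++ (p ∷ ps) q qs refl = dropN-++ ps q qs refl

ref-just : ∀ z h {v} → z ! h ≡ just v → ref z h ≡ firstBelow v (dropN h (indexed z))
ref-just z h z[h] with z ! h
ref-just z h refl | just _ = refl

ref-++ : ∀ A v B → ref (A ++ v ∷ B) (suc (length A)) ≡ firstBelow v (indexedFrom (2 + length A) B)
ref-++ A v B = begin
  ref (A ++ v ∷ B) (suc (length A))
    ≡⟨ ref-just (A ++ v ∷ B) _ (!-++ A v B) ⟩
  firstBelow v (dropN (suc (length A)) (indexed (A ++ v ∷ B)))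
    ≡⟨ cong (firstBelow v ∘ dropN (suc (length A))) (indexedFrom-++ 1 A (v ∷ B)) ⟩
  firstBelow v (dropN (suc (length A)) (indexed A ++ (suc (length A) , v) ∷ indexedFrom (2 + length A) B))
    ≡⟨ cong (firstBelow v) (dropN-++ (indexed A) _ _ (length-indexedFrom 1 A)) ⟩
  firstBelow v (indexedFrom (2 + length A) B) ∎

firstBelow-∷ : ∀ {v r} j w ps → firstBelow v ((j , w) ∷ ps) ≡ just r →
  (w <ℤ v × r ≡ j) ⊎ (v ≤ℤ w × firstBelow v ps ≡ just r)
firstBelow-∷ {v} j w ps found with w <? v
... | yes w<v = inj₁ (w<v , sym (just-injective found))
... | no  w≮v = inj₂ (ℤ.≮⇒≥ w≮v , found)

firstBelow-just : ∀ {v s} ps → firstBelow v ps ≡ just s →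
  ∃ λ M → ∃₂ λ c Q → ps ≡ M ++ (s , c) ∷ Q × c <ℤ v × All (λ q → v ≤ℤ val q) M
firstBelow-just ((j , w) ∷ ps) found with firstBelow-∷ j w ps found
... | inj₁ (w<v , refl) = [] , w , ps , refl , w<v , []
... | inj₂ (v≤w , found′) =
  let M , c , Q , ps≡ , c<v , v≤M = firstBelow-just ps found′
  in  (j , w) ∷ M , c , Q , cong ((j , w) ∷_) ps≡ , c<v , v≤w ∷ v≤M

module Transposition (A : List ℤ) (a b : ℤ) (B : List ℤ) where
  k : ℕ
  k = length A

  x y : List ℤ
  x = A ++ a ∷ b ∷ B
  y = A ++ b ∷ a ∷ B

  IA IB : List Entry
  IA = indexed A
  IB = indexedFrom (3 + k) B

  indexed-x : indexed x ≡ IA ++ (suc k , a) ∷ (2 + k , b) ∷ IB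
  indexed-x = indexedFrom-++ 1 A (a ∷ b ∷ B)

  indexed-y : indexed y ≡ IA ++ (suc k , b) ∷ (2 + k , a) ∷ IB
  indexed-y = indexedFrom-++ 1 A (b ∷ a ∷ B)

  ref-y : ref y (suc k) ≡ firstBelow b ((2 + k , a) ∷ IB)
  ref-y = ref-++ A b (a ∷ B)

  ref-x : ref x (2 + k) ≡ firstBelow b IB
  ref-x = begin
    ref x (2 + k)
      ≡⟨ cong₂ ref (++-assoc A [ a ] (b ∷ B)) (cong suc length-A∷ʳa) ⟨
    ref ((A ++ [ a ]) ++ b ∷ B) (suc (length (A ++ [ a ])))
      ≡⟨ ref-++ (A ++ [ a ]) b B ⟩
    firstBelow b (indexedFrom (2 + length (A ++ [ a ])) B)
      ≡⟨ cong (λ n → firstBelow b (indexedFrom (2 + n) B)) length-A∷ʳa ⟩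
    firstBelow b IB ∎
    where
    length-A∷ʳa : length (A ++ [ a ]) ≡ suc k
    length-A∷ʳa = trans (length-++ A) (ℕ.+-comm k 1)

  SN-differs-at-ascent : a <ℤ b → SN x (2 + k) ≢ SN y (2 + k)
  SN-differs-at-ascent a<b e = #suffixMinima-leftRun-ascent IA (suc k) a<b
    (trans (sym (SN-leftRun x _ _ b IB (trans indexed-x (sym (++-assoc IA _ _)))))
           (trans e (SN-leftRun y _ _ a IB (trans indexed-y (sym (++-assoc IA _ _))))))

  SN-differs-after-ascent : ∀ {s} → a <ℤ b → firstBelow b IB ≡ just s → SN x s ≢ SN y s
  SN-differs-after-ascent {s} a<b found e =
    let M , c , Q , IB≡ , c<b , b≤M = firstBelow-just IB found
        regroup : ∀ p q → IA ++ p ∷ q ∷ IB ≡ (IA ++ p ∷ q ∷ M) ++ (s , c) ∷ Q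
        regroup p q = trans (cong (λ I → IA ++ p ∷ q ∷ I) IB≡) (sym (++-assoc IA (p ∷ q ∷ M) _))
    in  #suffixMinima-leftRun-swap IA (suc k) (2 + k) M a<b c<b b≤M
          (trans (sym (SN-leftRun x _ s c Q (trans indexed-x (regroup _ _))))
                 (trans e (SN-leftRun y _ s c Q (trans indexed-y (regroup _ _)))))

  SN-iff : ∀ {r s} → ref y (suc k) ≡ just r → ref x (2 + k) ≡ just s →
           (SN x r ≢ SN y r) ⇔ (SN x s ≢ SN y s)
  SN-iff ref-y≡r ref-x≡s with firstBelow-∷ (2 + k) a IB (trans (sym ref-y) ref-y≡r)
  ... | inj₁ (a<b , refl) =
    mk⇔ (λ _ → SN-differs-after-ascent a<b (trans (sym ref-x) ref-x≡s)) (λ _ → SN-differs-at-ascent a<b)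
  ... | inj₂ (_ , found) with just-injective (trans (sym found) (trans (sym ref-x) ref-x≡s))
  ...   | refl = ⇔-refl

splitAtPair : ∀ (x : List ℤ) i → suc i < length x →
  ∃₂ λ A a → ∃₂ λ b B → x ≡ A ++ a ∷ b ∷ B × length A ≡ i
splitAtPair (a ∷ b ∷ B) zero    _         = [] , a , b , B , refl , refl
splitAtPair (c ∷ x)     (suc i) (s≤s i<n) =
  let A , a , b , B , x≡ , |A|≡i = splitAtPair x i i<n
  in  c ∷ A , a , b , B , cong (c ∷_) x≡ , cong suc |A|≡i

τ-++ : ∀ A (a b : ℤ) B → τ (A ++ a ∷ b ∷ B) (suc (length A)) ≡ A ++ b ∷ a ∷ B
τ-++ []          a b B = refl
τ-++ (c ∷ [])    a b B = refl
τ-++ (c ∷ d ∷ A) a b B = cong (c ∷_) (τ-++ (d ∷ A) a b B)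

-- Distinctness of the entries is not needed: splitMin resolves ties towards the first minimum.
corollary1 : (x : List ℤ) → Unique x → (i : ℕ) → 1 ≤ i → i < length x →
    (r s : ℕ) → ref (τ x i) i ≡ just r → ref x (suc i) ≡ just s →
    (SN x r ≢ SN (τ x i) r) ⇔ (SN x s ≢ SN (τ x i) s)
corollary1 x _ (suc i) _ i<|x| r s ref-y≡r ref-x≡s with splitAtPair x i i<|x|
... | A , a , b , B , refl , refl with τ (A ++ a ∷ b ∷ B) (suc (length A)) | τ-++ A a b B
...   | _ | refl = Transposition.SN-iff A a b B ref-y≡r ref-x≡s
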